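{- Let $n\in\mathbb{N}$ and let $n_0,n_1$ be integers with $n_0+n_1=n$. The following are equivalent: (1) $n=n_0+n_1$ is a hypercubic bipartition (HCBP) (with $n_0\ge n_1\ge1$); (2) $f(n)=n_1+f(n_1)+f(n_0)$ and $n_0\geq n_1\geq 1$; (3) $(n_0,n_1)=\left(\frac{n+d_i(n)}{2},\frac{n-d_i(n)}{2}\right)$ for some $i\in\{1,\ldots,\lceil\lg n\rceil\}$.
   Context: $\lg$ denotes the base-2 logarithm. The function $f:\mathbb{N}\to\mathbb{N}_0$ is defined by $f(1)=0$ and $f(n)=\lfloor n/2\rfloor+f(\lfloor n/2\rfloor)+f(\lceil n/2\rceil)$ for $n>1$. For $i\in\mathbb{N}$ and $n\in\mathbb{N}_0$, $d_i(n)=2^{i-1}-\left|(n\bmod 2^i)-2^{i-1}\right|$. For $k\ge1$ and $i\in\{0,\ldots,2^k-1\}$, $\tilde{\beta}_k(i)\in\{0,1\}^k$ is the point whose coordinates are the binary digits of $i$ written with $k$ digits, the least significant digit being the $k$-th coordinate, the next the $(k-1)$-th, and so on. For $n\ge 2$ and $k=\lceil\lg n\rceil$, a partition $n=n_0+n_1$ with $n_0\ge n_1\ge 1$ is a hypercubic bipartition (HCBP) if there is $i\in\{1,\ldots,k\}$ such that among the points $\tilde{\beta}_k(0),\ldots,\tilde{\beta}_k(n-1)$ the hyperplane $x_i=1/2$ separates $n_0$ of them from the other $n_1$. The number $1$ has no HCBP. -}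

module Defs where

open import Data.Nat using (ℕ; zero; suc; _+_; _*_; _∸_; _^_; _≤_; _<_; ∣_-_∣; NonZero)
open import Data.Nat.DivMod using (_/_; _%_)
open import Data.Nat.Properties using (m^n≢0)
open import Data.Nat.Logarithm using (⌈log₂_⌉)
open import Data.Fin using (Fin; toℕ)
open import Data.List using (List; length; filter; upTo)
open import Data.Product using (Σ; _×_; _,_)
open import Data.Sum using (_⊎_)
open import Relation.Binary.PropositionalEquality using (_≡_)
open import Data.Nat using (_≟_)

-- f(1) = 0, f(n) = ⌊n/2⌋ + f(⌊n/2⌋) + f(⌈n/2⌉) for n > 1.
-- Implemented by fuel recursion; fuel n suffices (arguments strictly decrease).
-- (f 0 = 0 is an irrelevant convention; the paper only uses n ≥ 1.)
fFuel : ℕ → ℕ → ℕ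
fFuel zero n = 0
fFuel (suc t) zero = 0
fFuel (suc t) (suc zero) = 0
fFuel (suc t) n@(suc (suc _)) = n / 2 + fFuel t (n / 2) + fFuel t (n ∸ n / 2)

f : ℕ → ℕ
f n = fFuel n n

d : ℕ → ℕ → ℕ
d i n = 2 ^ (i ∸ 1) ∸ ∣ _%_ n (2 ^ i) {{m^n≢0 2 i}} - 2 ^ (i ∸ 1) ∣

clg : ℕ → ℕ
clg n = ⌈log₂ n ⌉

-- j-th coordinate (j : Fin k, i.e. coordinate number toℕ j + 1) of β̃_k(m):
-- the binary digit of m of weight 2^(k - (toℕ j + 1)), so the k-th coordinate
-- is the least significant digit.
coord : (k : ℕ) → ℕ → Fin k → ℕ
coord k m j = (_/_ m (2 ^ (k ∸ suc (toℕ j))) {{m^n≢0 2 (k ∸ suc (toℕ j))}}) % 2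

countSide : (k : ℕ) → Fin k → ℕ → ℕ → ℕ
countSide k j b n = length (filter (λ m → coord k m j ≟ b) (upTo n))

IsHCBP : ℕ → ℕ → ℕ → Set
IsHCBP n n0 n1 =
  (2 ≤ n) × (n0 + n1 ≡ n) × (n1 ≤ n0) × (1 ≤ n1) ×
  Σ (Fin (clg n)) (λ j →
      ((countSide (clg n) j 0 n ≡ n0) × (countSide (clg n) j 1 n ≡ n1))
    ⊎ ((countSide (clg n) j 0 n ≡ n1) × (countSide (clg n) j 1 n ≡ n0)))

module Submission where

-- The cost f satisfies f a + f b + min a b ≤ f (a + b), with equality exactly for the dyadic
-- splits: those where some 2^j divides a or b and |a - b| ≤ 2^j.  Both facts are proved together
-- by well-founded induction on a + b, splitting on the parities of a and b, because f(2x) and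
-- f(2x + 1) unfold to f at x and x + 1.  As d_{j+1}(n) is the distance from n to the nearest
-- multiple of 2^{j+1}, a dyadic split with b ≤ a is exactly one with a - b = d_{j+1}(n) for some
-- j < ⌈lg n⌉, which gives (2) ⇔ (3).  Finally, among 0, …, n - 1 the numbers whose bit j is 0
-- outnumber those whose bit j is 1 by exactly d_{j+1}(n), so the hyperplane through the
-- coordinate reading bit j realises precisely the split with n0 - n1 = d_{j+1}(n): (1) ⇔ (3).

open import Defs

module Recurrence where
  open import Data.Nat
  open import Data.Nat.Properties
  open import Data.Nat.DivMod
  open import Data.Nat.Divisibility using (divides)
  open import Data.Nat.Tactic.RingSolver
  open import Relation.Binary.PropositionalEquality
  open ≡-Reasoning

  private
    half≤ : ∀ k → suc (suc k) / 2 ≤ suc k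
    half≤ k = <⇒≤pred (m/n<m (suc (suc k)) 2 (s≤s (s≤s z≤n)))

    rest≤ : ∀ k → suc (suc k) ∸ suc (suc k) / 2 ≤ suc k
    rest≤ k = ∸-monoʳ-≤ (suc (suc k)) (m≥n⇒m/n>0 {suc (suc k)} {2} (s≤s (s≤s z≤n)))

  fFuel-irrelevant : ∀ {t u} n → n ≤ t → n ≤ u → fFuel t n ≡ fFuel u n
  fFuel-irrelevant {zero}  {zero}  _ _ _ = refl
  fFuel-irrelevant {zero}  {suc u} zero _ _ = refl
  fFuel-irrelevant {suc t} {zero}  zero _ _ = refl
  fFuel-irrelevant {suc t} {suc u} zero _ _ = refl
  fFuel-irrelevant {suc t} {suc u} (suc zero) _ _ = refl
  fFuel-irrelevant {suc t} {suc u} n@(suc (suc k)) (s≤s n≤t) (s≤s n≤u) =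
    cong₂ (λ p q → n / 2 + p + q)
      (fFuel-irrelevant (n / 2) (≤-trans (half≤ k) n≤t) (≤-trans (half≤ k) n≤u))
      (fFuel-irrelevant (n ∸ n / 2) (≤-trans (rest≤ k) n≤t) (≤-trans (rest≤ k) n≤u))

  fFuel≡f : ∀ {t} n → n ≤ t → fFuel t n ≡ f n
  fFuel≡f n n≤t = fFuel-irrelevant n n≤t ≤-refl

  f-unfold : ∀ {n} → 2 ≤ n → f n ≡ n / 2 + f (n / 2) + f (n ∸ n / 2)
  f-unfold {suc (suc k)} (s≤s (s≤s _)) =
    cong₂ (λ p q → suc (suc k) / 2 + p + q) (fFuel≡f _ (half≤ k)) (fFuel≡f _ (rest≤ k))

  f-split : ∀ {n} x y → 2 ≤ n → x + y ≡ n → n / 2 ≡ x → f n ≡ x + f x + f y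
  f-split x y 2≤n refl n/2≡x = begin
    f (x + y)                                        ≡⟨ f-unfold 2≤n ⟩
    n / 2 + f (n / 2) + f (n ∸ n / 2)                ≡⟨ cong (λ h → h + f h + f (n ∸ h)) n/2≡x ⟩
    x + f x + f (x + y ∸ x)                          ≡⟨ cong (λ z → x + f x + f z) (m+n∸m≡n x y) ⟩
    x + f x + f y                                    ∎
    where n = x + y

  [2*x]/2≡x : ∀ x → 2 * x / 2 ≡ x
  [2*x]/2≡x x = trans (/-congˡ (*-comm 2 x)) (m*n/n≡m x 2)

  [1+2*x]/2≡x : ∀ x → (1 + 2 * x) / 2 ≡ x
  [1+2*x]/2≡x x = trans (+-distrib-/-∣ʳ 1 (divides x (*-comm 2 x))) ([2*x]/2≡x x)

  f-double : ∀ x → f (2 * x) ≡ x + f x + f x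
  f-double zero    = refl
  f-double (suc x) =
    f-split (suc x) (suc x) (*-monoʳ-≤ 2 (s≤s z≤n)) (x+x≡2*x (suc x)) ([2*x]/2≡x (suc x))
    where
    x+x≡2*x : ∀ y → y + y ≡ 2 * y
    x+x≡2*x = solve-∀

  f-double+1 : ∀ x → f (1 + 2 * x) ≡ x + f x + f (1 + x)
  f-double+1 zero    = refl
  f-double+1 (suc x) =
    f-split (suc x) (2 + x) (s≤s (s≤s z≤n)) (x+[1+x]≡1+2*x (suc x)) ([1+2*x]/2≡x (suc x))
    where
    x+[1+x]≡1+2*x : ∀ y → y + (1 + y) ≡ 1 + 2 * y
    x+[1+x]≡1+2*x = solve-∀

module DyadicPairs where
  open import Data.Nat
  open import Data.Nat.Properties
  open import Data.Nat.Divisibility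
  open import Data.Nat.Tactic.RingSolver
  open import Data.Product using (∃-syntax; _×_; _,_; proj₁; proj₂)
  import Data.Product as Product
  open import Data.Sum using (_⊎_; inj₁; inj₂)
  import Data.Sum as Sum
  open import Function.Bundles using (_⇔_; mk⇔; module Equivalence)
  open Equivalence using (to; from)
  open import Relation.Binary.PropositionalEquality
  open import Relation.Nullary using (¬_; yes; no)
  open import Data.Empty using (⊥-elim)

  Within : ℕ → ℕ → ℕ → Set
  Within j a b = a ≤ b + 2 ^ j × b ≤ a + 2 ^ j

  Dyadic : ℕ → ℕ → Set
  Dyadic a b = ∃[ j ] Within j a b × (2 ^ j ∣ a ⊎ 2 ^ j ∣ b)

  Dyadic-sym : ∀ {a b} → Dyadic a b → Dyadic b a
  Dyadic-sym (j , (a≤ , b≤) , div) = j , (b≤ , a≤) , Sum.swap div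

  Dyadic-refl : ∀ a → Dyadic a a
  Dyadic-refl a = 0 , (m≤m+n a 1 , m≤m+n a 1) , inj₁ (1∣ a)

  n≤2^n : ∀ n → n ≤ 2 ^ n
  n≤2^n zero    = z≤n
  n≤2^n (suc n) = +-mono-≤ (m^n>0 2 n) (≤-trans (n≤2^n n) (m≤m+n (2 ^ n) 0))

  Dyadic-zero : ∀ a → Dyadic a 0
  Dyadic-zero a = a , (n≤2^n a , z≤n) , inj₂ ((2 ^ a) ∣0)

  private
    2*-≤-+-⇔ : ∀ {a} b c → 2 * a ≤ 2 * b + 2 * c ⇔ a ≤ b + c
    2*-≤-+-⇔ {a} b c = mk⇔
      (λ le → *-cancelˡ-≤ 2 (subst (2 * a ≤_) (sym (*-distribˡ-+ 2 b c)) le))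
      (λ le → subst (2 * a ≤_) (*-distribˡ-+ 2 b c) (*-monoʳ-≤ 2 le))

    2*-≤-1+2*-⇔ : ∀ {a b} → 2 * a ≤ 1 + 2 * b ⇔ a ≤ b
    2*-≤-1+2*-⇔ {a} {b} = mk⇔
      (λ le → ≤-pred (*-cancelˡ-< 2 a (1 + b)
                (≤-<-trans le (≤-reflexive (sym (*-distribˡ-+ 2 1 b))))))
      (λ le → ≤-trans (*-monoʳ-≤ 2 le) (n≤1+n _))

    1+2*-≤-2*-⇔ : ∀ {a b} → 1 + 2 * a ≤ 2 * b ⇔ a < b
    1+2*-≤-2*-⇔ {a} {b} = mk⇔ (*-cancelˡ-< 2 a b) (*-monoʳ-< 2)

  Within-double : ∀ {j x y} → Within (suc j) (2 * x) (2 * y) ⇔ Within j x y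
  Within-double {j} {x} {y} =
    mk⇔ (Product.map (to (2*-≤-+-⇔ y (2 ^ j))) (to (2*-≤-+-⇔ x (2 ^ j))))
        (Product.map (from (2*-≤-+-⇔ y (2 ^ j))) (from (2*-≤-+-⇔ x (2 ^ j))))

  Within₀-double⇒≡ : ∀ {x y} → Within 0 (2 * x) (2 * y) → x ≡ y
  Within₀-double⇒≡ {x} {y} (x≤ , y≤) =
    ≤-antisym (to 2*-≤-1+2*-⇔ (subst (2 * x ≤_) (+-comm (2 * y) 1) x≤))
              (to 2*-≤-1+2*-⇔ (subst (2 * y ≤_) (+-comm (2 * x) 1) y≤))

  Within₀-odd-odd⇒≡ : ∀ {x y} → Within 0 (1 + 2 * x) (1 + 2 * y) → x ≡ y
  Within₀-odd-odd⇒≡ {x} {y} (x≤ , y≤) =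
    ≤-antisym (to 2*-≤-1+2*-⇔ (subst (2 * x ≤_) (+-comm (2 * y) 1) (≤-pred x≤)))
              (to 2*-≤-1+2*-⇔ (subst (2 * y ≤_) (+-comm (2 * x) 1) (≤-pred y≤)))

  Within₀-odd-even : ∀ {x y} → Within 0 (1 + 2 * x) (2 * y) ⇔ (x ≤ y × y ≤ 1 + x)
  Within₀-odd-even {x} {y} = mk⇔
    (λ (x≤ , y≤) → *-cancelˡ-≤ 2 (≤-pred (subst (1 + 2 * x ≤_) (+-comm (2 * y) 1) x≤))
                 , *-cancelˡ-≤ 2 (subst (2 * y ≤_) (1+2*x+1≡2*[1+x] x) y≤))
    (λ (x≤y , y≤) → subst (1 + 2 * x ≤_) (+-comm 1 (2 * y)) (s≤s (*-monoʳ-≤ 2 x≤y))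
                  , subst (2 * y ≤_) (sym (1+2*x+1≡2*[1+x] x)) (*-monoʳ-≤ 2 y≤))
    where
    1+2*x+1≡2*[1+x] : ∀ x → 1 + 2 * x + 1 ≡ 2 * (1 + x)
    1+2*x+1≡2*[1+x] = solve-∀

  Within-odd-even : ∀ {K x y} → Within (suc K) (1 + 2 * x) (2 * y) ⇔ (x < y + 2 ^ K × y ≤ x + 2 ^ K)
  Within-odd-even {K} {x} {y} = mk⇔
    (λ (x≤ , y≤) → to 1+2*-≤-2*-⇔ (subst (1 + 2 * x ≤_) (sym (*-distribˡ-+ 2 y (2 ^ K))) x≤)
                 , to 2*-≤-1+2*-⇔ (subst (2 * y ≤_) (cong suc (sym (*-distribˡ-+ 2 x (2 ^ K)))) y≤))
    (λ (x< , y≤) → subst (1 + 2 * x ≤_) (*-distribˡ-+ 2 y (2 ^ K)) (from 1+2*-≤-2*-⇔ x<)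
                 , subst (2 * y ≤_) (cong suc (*-distribˡ-+ 2 x (2 ^ K))) (from 2*-≤-1+2*-⇔ y≤))

  private
    2∣2^suc : ∀ j → 2 ∣ 2 ^ suc j
    2∣2^suc j = m∣m*n (2 ^ j)

    2^suc∣⇒2∣ : ∀ {n} j → 2 ^ suc j ∣ n → 2 ∣ n
    2^suc∣⇒2∣ j = ∣-trans (2∣2^suc j)

    2∣+2^suc⇒2∣ : ∀ {m} j → 2 ∣ m + 2 ^ suc j → 2 ∣ m
    2∣+2^suc⇒2∣ {m} j d = ∣m+n∣m⇒∣n (subst (2 ∣_) (+-comm m _) d) (2∣2^suc j)

    2∣⇒¬2∣1+ : ∀ {n} → 2 ∣ n → ¬ 2 ∣ 1 + n
    2∣⇒¬2∣1+ {n} 2∣n 2∣1+n with ∣1⇒≡1 (∣m+n∣m⇒∣n (subst (2 ∣_) (+-comm 1 n) 2∣1+n) 2∣n)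
    ... | ()

  Dyadic-double⇔ : ∀ {x y} → Dyadic (2 * x) (2 * y) ⇔ Dyadic x y
  Dyadic-double⇔ {x} = mk⇔ halve double
    where
    double : ∀ {y} → Dyadic x y → Dyadic (2 * x) (2 * y)
    double (j , w , div) = suc j , from (Within-double {j}) w , Sum.map (*-monoʳ-∣ 2) (*-monoʳ-∣ 2) div
    halve : ∀ {y} → Dyadic (2 * x) (2 * y) → Dyadic x y
    halve (zero  , w , _)   = subst (Dyadic x) (Within₀-double⇒≡ w) (Dyadic-refl x)
    halve (suc j , w , div) = j , to (Within-double {j}) w , Sum.map (*-cancelˡ-∣ 2) (*-cancelˡ-∣ 2) div

  Dyadic-odd-odd⇔ : ∀ {x y} → Dyadic (1 + 2 * x) (1 + 2 * y) ⇔ x ≡ y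
  Dyadic-odd-odd⇔ {x} = mk⇔ halve (λ { refl → Dyadic-refl _ })
    where
    halve : ∀ {y} → Dyadic (1 + 2 * x) (1 + 2 * y) → x ≡ y
    halve (zero  , w , _)      = Within₀-odd-odd⇒≡ w
    halve (suc j , _ , inj₁ d) = ⊥-elim (2∣⇒¬2∣1+ (m∣m*n x) (2^suc∣⇒2∣ j d))
    halve {y} (suc j , _ , inj₂ d) = ⊥-elim (2∣⇒¬2∣1+ (m∣m*n y) (2^suc∣⇒2∣ j d))

  Dyadic-odd-even-adjacent : ∀ {x y} → x ≤ y → y ≤ 1 + x → Dyadic (1 + 2 * x) (2 * y)
  Dyadic-odd-even-adjacent x≤y y≤1+x = 0 , from Within₀-odd-even (x≤y , y≤1+x) , inj₁ (1∣ _)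

  Dyadic-odd-even-aligned : ∀ {x y} K → 2 ^ K ∣ y → x < y + 2 ^ K → y ≤ x + 2 ^ K →
                            Dyadic (1 + 2 * x) (2 * y)
  Dyadic-odd-even-aligned K d x< y≤ = suc K , from (Within-odd-even {K}) (x< , y≤) , inj₂ (*-monoʳ-∣ 2 d)

  Dyadic-odd-even-+2 : ∀ {x y} → 2 ∣ x → y ≡ 2 + x → Dyadic (1 + 2 * x) (2 * y)
  Dyadic-odd-even-+2 {x} d refl =
    Dyadic-odd-even-aligned 1 (∣m∣n⇒∣m+n ∣-refl d) (≤-trans (n≤1+n (1 + x)) (m≤m+n (2 + x) 2))
      (≤-reflexive (+-comm 2 x))

  Dyadic-odd-even-predecessor : ∀ {x y} j → 2 ^ suc j ∣ 1 + x → x ≡ y + 1 → Dyadic (1 + 2 * x) (2 * y)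
  Dyadic-odd-even-predecessor {y = y} j d refl =
    Dyadic-odd-even-aligned 1 2∣y (≤-reflexive (trans (cong suc (+-comm y 1)) (+-comm 2 y)))
                              (≤-trans (m≤m+n y 1) (m≤m+n (y + 1) 2))
    where
    2∣y : 2 ∣ y
    2∣y = ∣m+n∣m⇒∣n (subst (2 ∣_) (cong suc (+-comm y 1)) (2^suc∣⇒2∣ j d)) ∣-refl

  Dyadic-odd-even⁻ : ∀ {x y} → Dyadic (1 + 2 * x) (2 * y) → Dyadic x y × Dyadic (1 + x) y
  Dyadic-odd-even⁻ {x} {y} (zero , w , _) =
    (0 , (≤-trans x≤y (m≤m+n y 1) , subst (y ≤_) (+-comm 1 x) y≤1+x) , inj₁ (1∣ x)) ,
    (0 , (subst (suc x ≤_) (+-comm 1 y) (s≤s x≤y) , ≤-trans y≤1+x (m≤m+n (1 + x) 1)) , inj₁ (1∣ (1 + x)))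
    where
    x≤y = proj₁ (to Within₀-odd-even w)
    y≤1+x = proj₂ (to Within₀-odd-even w)
  Dyadic-odd-even⁻ {x} (suc K , _ , inj₁ d) = ⊥-elim (2∣⇒¬2∣1+ (m∣m*n x) (2^suc∣⇒2∣ K d))
  Dyadic-odd-even⁻ {x} {y} (suc K , w , inj₂ d) =
    (K , (<⇒≤ x< , y≤) , inj₂ d′) , (K , (x< , ≤-trans y≤ (+-monoˡ-≤ (2 ^ K) (n≤1+n x))) , inj₂ d′)
    where
    x< = proj₁ (to (Within-odd-even {K}) w)
    y≤ = proj₂ (to (Within-odd-even {K}) w)
    d′ = *-cancelˡ-∣ 2 d

  -- Two witnesses dividing y combine by taking the larger exponent.  A witness 2^(1+j) dividing
  -- x or 1 + x fixes the parity of x, and in the remaining configurations y is within 2 of x,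
  -- where the exponents 0 or 1 work.
  Dyadic-odd-even⁺ : ∀ {x y} → Dyadic x y → Dyadic (1 + x) y → Dyadic (1 + 2 * x) (2 * y)
  Dyadic-odd-even⁺ {x} {y} (j₁ , (_ , y≤) , inj₂ d₁) (j₂ , (x< , _) , inj₂ d₂) with ≤-total j₁ j₂
  ... | inj₁ j₁≤j₂ = Dyadic-odd-even-aligned j₂ d₂ x< (≤-trans y≤ (+-monoʳ-≤ x (^-monoʳ-≤ 2 j₁≤j₂)))
  ... | inj₂ j₂≤j₁ = Dyadic-odd-even-aligned j₁ d₁ (≤-trans x< (+-monoʳ-≤ y (^-monoʳ-≤ 2 j₂≤j₁))) y≤
  Dyadic-odd-even⁺ {x} {y} (j₁ , (_ , y≤) , inj₁ d₁) (j₂ , (x< , y≤′) , inj₂ d₂) with y ≤? x + 2 ^ j₂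
  ... | yes y≤″ = Dyadic-odd-even-aligned j₂ d₂ x< y≤″
  ... | no y≰ = overshoot j₁ j₂ d₁ d₂ y≤ (≤-antisym y≤′ (≰⇒> y≰))
    where
    overshoot : ∀ j₁ j₂ → 2 ^ j₁ ∣ x → 2 ^ j₂ ∣ y → y ≤ x + 2 ^ j₁ → y ≡ 1 + x + 2 ^ j₂ →
                Dyadic (1 + 2 * x) (2 * y)
    overshoot zero j₂ _ _ y≤ refl = ⊥-elim (<⇒≱ (s≤s (+-monoʳ-≤ x (m^n>0 2 j₂))) y≤)
    overshoot (suc j₁) zero d₁ _ _ refl = Dyadic-odd-even-+2 (2^suc∣⇒2∣ j₁ d₁) (+-comm (1 + x) 1)
    overshoot (suc j₁) (suc j₂) d₁ d₂ _ refl =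
      ⊥-elim (2∣⇒¬2∣1+ (2^suc∣⇒2∣ j₁ d₁) (2∣+2^suc⇒2∣ j₂ (2^suc∣⇒2∣ j₂ d₂)))
  Dyadic-odd-even⁺ {x} {y} (j₁ , (x≤ , y≤) , inj₂ d₁) (j₂ , (x< , _) , inj₁ d₂) with 1 + x ≤? y + 2 ^ j₁
  ... | yes x<′ = Dyadic-odd-even-aligned j₁ d₁ x<′ y≤
  ... | no x≮ = undershoot j₁ j₂ d₁ d₂ x< (≤-antisym x≤ (≤-pred (≰⇒> x≮)))
    where
    undershoot : ∀ j₁ j₂ → 2 ^ j₁ ∣ y → 2 ^ j₂ ∣ 1 + x → 1 + x ≤ y + 2 ^ j₂ → x ≡ y + 2 ^ j₁ →
                 Dyadic (1 + 2 * x) (2 * y)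
    undershoot j₁ zero _ _ x< refl = ⊥-elim (<⇒≱ (s≤s (+-monoʳ-≤ y (m^n>0 2 j₁))) x<)
    undershoot zero (suc j₂) _ d₂ _ x≡y+1 = Dyadic-odd-even-predecessor j₂ d₂ x≡y+1
    undershoot (suc j₁) (suc j₂) d₁ d₂ _ refl =
      ⊥-elim (2∣⇒¬2∣1+ (∣m∣n⇒∣m+n (2^suc∣⇒2∣ j₁ d₁) (2∣2^suc j₁)) (2^suc∣⇒2∣ j₂ d₂))
  Dyadic-odd-even⁺ (suc j₁ , _ , inj₁ d₁) (suc j₂ , _ , inj₁ d₂) =
    ⊥-elim (2∣⇒¬2∣1+ (2^suc∣⇒2∣ j₁ d₁) (2^suc∣⇒2∣ j₂ d₂))
  Dyadic-odd-even⁺ {x} {y} (zero , (x≤ , y≤) , inj₁ _) (j₂ , (x< , _) , inj₁ d₂) with x ≤? y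
  ... | yes x≤y = Dyadic-odd-even-adjacent x≤y (subst (y ≤_) (+-comm x 1) y≤)
  ... | no x≰y = predecessor j₂ d₂ x< (≤-antisym x≤ (subst (_≤ x) (+-comm 1 y) (≰⇒> x≰y)))
    where
    predecessor : ∀ j₂ → 2 ^ j₂ ∣ 1 + x → 1 + x ≤ y + 2 ^ j₂ → x ≡ y + 1 → Dyadic (1 + 2 * x) (2 * y)
    predecessor zero _ x< refl = ⊥-elim (<-irrefl refl x<)
    predecessor (suc j₂) d₂ _ x≡y+1 = Dyadic-odd-even-predecessor j₂ d₂ x≡y+1
  Dyadic-odd-even⁺ {x} {y} (suc j₁ , _ , inj₁ d₁) (zero , (x< , y≤) , inj₁ _) with y ≤? 1 + x
  ... | yes y≤1+x = Dyadic-odd-even-adjacent (≤-pred (subst (1 + x ≤_) (+-comm y 1) x<)) y≤1+x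
  ... | no y≰ = Dyadic-odd-even-+2 (2^suc∣⇒2∣ j₁ d₁)
                  (≤-antisym (subst (y ≤_) (+-comm (1 + x) 1) y≤) (≰⇒> y≰))

  Dyadic-odd-even⇔ : ∀ {x y} → Dyadic (1 + 2 * x) (2 * y) ⇔ (Dyadic x y × Dyadic (1 + x) y)
  Dyadic-odd-even⇔ = mk⇔ Dyadic-odd-even⁻ (λ (d₁ , d₂) → Dyadic-odd-even⁺ d₁ d₂)

module OptimalSplits where
  open import Data.Nat
  open import Data.Nat.Properties
  open import Data.Nat.Induction using (Acc; acc; <-wellFounded)
  open import Data.Nat.Tactic.RingSolver
  open import Data.Product using (_×_; _,_; proj₁)
  open import Data.Product.Function.NonDependent.Propositional using (_×-⇔_)
  open import Data.Sum using (inj₁; inj₂)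
  open import Data.Empty using (⊥-elim)
  open import Relation.Nullary using (yes; no)
  open import Function.Bundles using (_⇔_; mk⇔; module Equivalence)
  open import Function.Properties.Equivalence using () renaming (trans to ⇔-trans; sym to ⇔-sym)
  open import Relation.Binary.Definitions using (tri<; tri≈; tri>)
  open import Relation.Binary.PropositionalEquality
  open Equivalence using (to; from)
  open ≡-Reasoning
  open Recurrence
  open DyadicPairs

  private
    2*n≡n+n : ∀ n → 2 * n ≡ n + n
    2*n≡n+n = solve-∀

    1+2*n≡n+[1+n] : ∀ n → 1 + 2 * n ≡ n + (1 + n)
    1+2*n≡n+[1+n] = solve-∀

  splitCost : ℕ → ℕ → ℕ
  splitCost a b = f a + f b + a ⊓ b

  splitCost-comm : ∀ a b → splitCost a b ≡ splitCost b a
  splitCost-comm a b = cong₂ _+_ (+-comm (f a) (f b)) (⊓-comm a b)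

  splitCost-diagonal : ∀ a → splitCost a a ≡ f (a + a)
  splitCost-diagonal a = begin
    f a + f a + a ⊓ a  ≡⟨ cong (f a + f a +_) (⊓-idem a) ⟩
    f a + f a + a      ≡⟨ +-comm (f a + f a) a ⟩
    a + (f a + f a)    ≡⟨ +-assoc a (f a) (f a) ⟨
    a + f a + f a      ≡⟨ f-double a ⟨
    f (2 * a)          ≡⟨ cong f (2*n≡n+n a) ⟩
    f (a + a)          ∎

  [1+2*x]⊓[2*y] : ∀ x y → (1 + 2 * x) ⊓ (2 * y) ≡ x ⊓ y + (1 + x) ⊓ y
  [1+2*x]⊓[2*y] x y with x <? y
  ... | yes x<y = begin
    (1 + 2 * x) ⊓ (2 * y)  ≡⟨ m≤n⇒m⊓n≡m (*-monoʳ-< 2 x<y) ⟩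
    1 + 2 * x              ≡⟨ 1+2*n≡n+[1+n] x ⟩
    x + (1 + x)            ≡⟨ cong₂ _+_ (m≤n⇒m⊓n≡m (<⇒≤ x<y)) (m≤n⇒m⊓n≡m x<y) ⟨
    x ⊓ y + (1 + x) ⊓ y    ∎
  ... | no x≮y = begin
    (1 + 2 * x) ⊓ (2 * y)  ≡⟨ m≥n⇒m⊓n≡n (≤-trans (*-monoʳ-≤ 2 y≤x) (n≤1+n _)) ⟩
    2 * y                  ≡⟨ 2*n≡n+n y ⟩
    y + y                  ≡⟨ cong₂ _+_ (m≥n⇒m⊓n≡n y≤x) (m≥n⇒m⊓n≡n (≤-trans y≤x (n≤1+n x))) ⟨
    x ⊓ y + (1 + x) ⊓ y    ∎
    where y≤x = ≮⇒≥ x≮y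

  2*[x⊓y]≤[1+x]⊓y+x⊓[1+y] : ∀ x y → 2 * (x ⊓ y) ≤ (1 + x) ⊓ y + x ⊓ (1 + y)
  2*[x⊓y]≤[1+x]⊓y+x⊓[1+y] x y =
    ≤-trans (≤-reflexive (2*n≡n+n (x ⊓ y))) (+-mono-≤ (⊓-monoˡ-≤ y (n≤1+n x)) (⊓-monoʳ-≤ x (n≤1+n y)))

  [1+x]⊓y+x⊓[1+y]≤2*[x⊓y]⇒≡ : ∀ {x y} → (1 + x) ⊓ y + x ⊓ (1 + y) ≤ 2 * (x ⊓ y) → x ≡ y
  [1+x]⊓y+x⊓[1+y]≤2*[x⊓y]⇒≡ {x} {y} le with <-cmp x y
  ... | tri≈ _ x≡y _ = x≡y
  ... | tri< x<y _ _ =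
    ⊥-elim (<⇒≱ (+-mono-<-≤ left< (⊓-monoʳ-≤ x (n≤1+n y))) (≤-trans le (≤-reflexive (2*n≡n+n (x ⊓ y)))))
    where
    left< : x ⊓ y < (1 + x) ⊓ y
    left< = subst₂ _<_ (sym (m≤n⇒m⊓n≡m (<⇒≤ x<y))) (sym (m≤n⇒m⊓n≡m x<y)) (n<1+n x)
  ... | tri> _ _ y<x =
    ⊥-elim (<⇒≱ (+-mono-≤-< (⊓-monoˡ-≤ y (n≤1+n x)) right<) (≤-trans le (≤-reflexive (2*n≡n+n (x ⊓ y)))))
    where
    right< : x ⊓ y < x ⊓ (1 + y)
    right< = subst₂ _<_ (sym (m≥n⇒m⊓n≡n (<⇒≤ y<x))) (sym (m≥n⇒m⊓n≡n y<x)) (n<1+n y)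

  splitCost-even-even : ∀ x y → splitCost (2 * x) (2 * y) ≡ (x + y) + (splitCost x y + splitCost x y)
  splitCost-even-even x y = begin
    f (2 * x) + f (2 * y) + (2 * x) ⊓ (2 * y)
      ≡⟨ cong₂ (λ p q → p + q + (2 * x) ⊓ (2 * y)) (f-double x) (f-double y) ⟩
    (x + f x + f x) + (y + f y + f y) + (2 * x) ⊓ (2 * y)
      ≡⟨ cong ((x + f x + f x) + (y + f y + f y) +_) (*-distribˡ-⊓ 2 x y) ⟨
    (x + f x + f x) + (y + f y + f y) + 2 * (x ⊓ y)
      ≡⟨ regroup x y (f x) (f y) (x ⊓ y) ⟩
    (x + y) + (splitCost x y + splitCost x y) ∎
    where
    regroup : ∀ x y a b m → (x + a + a) + (y + b + b) + 2 * m ≡ (x + y) + ((a + b + m) + (a + b + m))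
    regroup = solve-∀

  f-even+even : ∀ x y → f (2 * x + 2 * y) ≡ (x + y) + (f (x + y) + f (x + y))
  f-even+even x y = begin
    f (2 * x + 2 * y)                 ≡⟨ cong f (*-distribˡ-+ 2 x y) ⟨
    f (2 * (x + y))                   ≡⟨ f-double (x + y) ⟩
    x + y + f (x + y) + f (x + y)     ≡⟨ +-assoc (x + y) _ _ ⟩
    (x + y) + (f (x + y) + f (x + y)) ∎

  splitCost-odd-even : ∀ x y →
    splitCost (1 + 2 * x) (2 * y) ≡ (x + y) + (splitCost x y + splitCost (1 + x) y)
  splitCost-odd-even x y = begin
    f (1 + 2 * x) + f (2 * y) + (1 + 2 * x) ⊓ (2 * y)
      ≡⟨ cong₂ (λ p q → p + q + (1 + 2 * x) ⊓ (2 * y)) (f-double+1 x) (f-double y) ⟩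
    (x + f x + f (1 + x)) + (y + f y + f y) + (1 + 2 * x) ⊓ (2 * y)
      ≡⟨ cong ((x + f x + f (1 + x)) + (y + f y + f y) +_) ([1+2*x]⊓[2*y] x y) ⟩
    (x + f x + f (1 + x)) + (y + f y + f y) + (x ⊓ y + (1 + x) ⊓ y)
      ≡⟨ regroup x y (f x) (f (1 + x)) (f y) (x ⊓ y) ((1 + x) ⊓ y) ⟩
    (x + y) + (splitCost x y + splitCost (1 + x) y) ∎
    where
    regroup : ∀ x y a a′ b m m′ →
              (x + a + a′) + (y + b + b) + (m + m′) ≡ (x + y) + ((a + b + m) + (a′ + b + m′))
    regroup = solve-∀

  f-odd+even : ∀ x y → f ((1 + 2 * x) + 2 * y) ≡ (x + y) + (f (x + y) + f ((1 + x) + y))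
  f-odd+even x y = begin
    f ((1 + 2 * x) + 2 * y)               ≡⟨ cong (λ n → f (suc n)) (*-distribˡ-+ 2 x y) ⟨
    f (1 + 2 * (x + y))                   ≡⟨ f-double+1 (x + y) ⟩
    x + y + f (x + y) + f (1 + (x + y))   ≡⟨ +-assoc (x + y) _ _ ⟩
    (x + y) + (f (x + y) + f (1 + x + y)) ∎

  splitCost-odd-odd : ∀ x y → splitCost (1 + 2 * x) (1 + 2 * y) ≡
                      (1 + x + y) + ((f x + f (1 + x) + f y + f (1 + y)) + 2 * (x ⊓ y))
  splitCost-odd-odd x y = begin
    f (1 + 2 * x) + f (1 + 2 * y) + (1 + 2 * x) ⊓ (1 + 2 * y)
      ≡⟨ cong₂ (λ p q → p + q + suc ((2 * x) ⊓ (2 * y))) (f-double+1 x) (f-double+1 y) ⟩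
    (x + f x + f (1 + x)) + (y + f y + f (1 + y)) + (1 + (2 * x) ⊓ (2 * y))
      ≡⟨ cong (λ m → (x + f x + f (1 + x)) + (y + f y + f (1 + y)) + (1 + m)) (*-distribˡ-⊓ 2 x y) ⟨
    (x + f x + f (1 + x)) + (y + f y + f (1 + y)) + (1 + 2 * (x ⊓ y))
      ≡⟨ regroup x y (f x) (f (1 + x)) (f y) (f (1 + y)) (x ⊓ y) ⟩
    (1 + x + y) + ((f x + f (1 + x) + f y + f (1 + y)) + 2 * (x ⊓ y)) ∎
    where
    regroup : ∀ x y a a′ b b′ m → (x + a + a′) + (y + b + b′) + (1 + 2 * m) ≡
              (1 + x + y) + ((a + a′ + b + b′) + 2 * m)
    regroup = solve-∀

  f-odd+odd : ∀ x y → f ((1 + 2 * x) + (1 + 2 * y)) ≡ (1 + x + y) + (f (1 + x + y) + f (1 + x + y))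
  f-odd+odd x y = begin
    f ((1 + 2 * x) + (1 + 2 * y))                   ≡⟨ cong f (sum≡ x y) ⟩
    f (2 * (1 + x + y))                             ≡⟨ f-double (1 + x + y) ⟩
    1 + x + y + f (1 + x + y) + f (1 + x + y)       ≡⟨ +-assoc (1 + x + y) _ _ ⟩
    (1 + x + y) + (f (1 + x + y) + f (1 + x + y))   ∎
    where
    sum≡ : ∀ x y → (1 + 2 * x) + (1 + 2 * y) ≡ 2 * (1 + x + y)
    sum≡ = solve-∀

  SplitCharacterisation : ℕ → ℕ → Set
  SplitCharacterisation a b = splitCost a b ≤ f (a + b) × (splitCost a b ≡ f (a + b) ⇔ Dyadic a b)

  private
    +-tight : ∀ {s₁ s₂ t₁ t₂} → s₁ ≤ t₁ → s₂ ≤ t₂ → s₁ + s₂ ≡ t₁ + t₂ ⇔ (s₁ ≡ t₁ × s₂ ≡ t₂)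
    +-tight {s₁} {s₂} {t₁} {t₂} s₁≤t₁ s₂≤t₂ = mk⇔ split (λ (e₁ , e₂) → cong₂ _+_ e₁ e₂)
      where
      split : s₁ + s₂ ≡ t₁ + t₂ → s₁ ≡ t₁ × s₂ ≡ t₂
      split eq with m≤n⇒m<n∨m≡n s₁≤t₁ | m≤n⇒m<n∨m≡n s₂≤t₂
      ... | inj₂ e₁ | inj₂ e₂ = e₁ , e₂
      ... | inj₁ s₁<t₁ | _ = ⊥-elim (<-irrefl eq (+-mono-<-≤ s₁<t₁ s₂≤t₂))
      ... | inj₂ _ | inj₁ s₂<t₂ = ⊥-elim (<-irrefl eq (+-mono-≤-< s₁≤t₁ s₂<t₂))

    ×-idem : ∀ {P : Set} → (P × P) ⇔ P
    ×-idem = mk⇔ proj₁ (λ p → p , p)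

  characterise-shifted : ∀ {a b} K {s t} → splitCost a b ≡ K + s → f (a + b) ≡ K + t →
                         s ≤ t → (s ≡ t ⇔ Dyadic a b) → SplitCharacterisation a b
  characterise-shifted K cost≡ f≡ s≤t s≡t⇔D =
    subst₂ _≤_ (sym cost≡) (sym f≡) (+-monoʳ-≤ K s≤t) ,
    ⇔-trans (mk⇔ (λ eq → +-cancelˡ-≡ K _ _ (trans (sym cost≡) (trans eq f≡)))
                 (λ eq → trans cost≡ (trans (cong (K +_) eq) (sym f≡))))
            s≡t⇔D

  characterise-zero : ∀ a → SplitCharacterisation a 0
  characterise-zero a =
    ≤-reflexive cost≡f , mk⇔ (λ _ → Dyadic-zero a) (λ _ → cost≡f)
    where
    cost≡f : splitCost a 0 ≡ f (a + 0)
    cost≡f = begin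
      f a + 0 + a ⊓ 0  ≡⟨ cong (f a + 0 +_) (⊓-zeroʳ a) ⟩
      f a + 0 + 0      ≡⟨ +-identityʳ (f a + 0) ⟩
      f a + 0          ≡⟨ +-identityʳ (f a) ⟩
      f a              ≡⟨ cong f (+-identityʳ a) ⟨
      f (a + 0)        ∎

  characterise-flip : ∀ {a b} → SplitCharacterisation a b → SplitCharacterisation b a
  characterise-flip {a} {b} (bound , tight⇔D) =
    subst₂ _≤_ (splitCost-comm a b) (cong f (+-comm a b)) bound ,
    mk⇔ (λ eq → Dyadic-sym (to tight⇔D (trans (splitCost-comm a b) (trans eq (cong f (+-comm b a))))))
        (λ d → trans (splitCost-comm b a) (trans (from tight⇔D (Dyadic-sym d)) (cong f (+-comm a b))))

  characterise-even-even : ∀ x y → SplitCharacterisation x y → SplitCharacterisation (2 * x) (2 * y)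
  characterise-even-even x y (S≤F , S≡F⇔D) =
    characterise-shifted (x + y) (splitCost-even-even x y) (f-even+even x y) (+-mono-≤ S≤F S≤F)
      (⇔-trans (+-tight S≤F S≤F) (⇔-trans ×-idem (⇔-trans S≡F⇔D (⇔-sym Dyadic-double⇔))))

  characterise-odd-even : ∀ x y → SplitCharacterisation x y → SplitCharacterisation (1 + x) y →
                          SplitCharacterisation (1 + 2 * x) (2 * y)
  characterise-odd-even x y (S₁≤F₁ , eqv₁) (S₂≤F₂ , eqv₂) =
    characterise-shifted (x + y) (splitCost-odd-even x y) (f-odd+even x y) (+-mono-≤ S₁≤F₁ S₂≤F₂)
      (⇔-trans (+-tight S₁≤F₁ S₂≤F₂) (⇔-trans (eqv₁ ×-⇔ eqv₂) (⇔-sym Dyadic-odd-even⇔)))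

  characterise-odd-odd : ∀ {x y} → splitCost (1 + x) y ≤ f (1 + x + y) →
                         splitCost x (1 + y) ≤ f (x + (1 + y)) → SplitCharacterisation (1 + 2 * x) (1 + 2 * y)
  characterise-odd-odd {x} {y} bound₁ bound₂ =
    characterise-shifted (1 + x + y) (splitCost-odd-odd x y) (f-odd+odd x y) s≤t
      (⇔-trans (mk⇔ s≡t⇒x≡y x≡y⇒s≡t) (⇔-sym Dyadic-odd-odd⇔))
    where
    A = f x + f (1 + x) + f y + f (1 + y)
    F = f (1 + x + y)
    neighbours : A + ((1 + x) ⊓ y + x ⊓ (1 + y)) ≡ splitCost (1 + x) y + splitCost x (1 + y)
    neighbours = regroup (f x) (f (1 + x)) (f y) (f (1 + y)) ((1 + x) ⊓ y) (x ⊓ (1 + y))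
      where
      regroup : ∀ a a′ b b′ m₁ m₂ → (a + a′ + b + b′) + (m₁ + m₂) ≡ (a′ + b + m₁) + (a + b′ + m₂)
      regroup = solve-∀
    neighbours≤ : A + ((1 + x) ⊓ y + x ⊓ (1 + y)) ≤ F + F
    neighbours≤ = ≤-trans (≤-reflexive neighbours)
                          (+-mono-≤ bound₁ (subst (λ n → splitCost x (1 + y) ≤ f n) (+-suc x y) bound₂))
    s≤t : A + 2 * (x ⊓ y) ≤ F + F
    s≤t = ≤-trans (+-monoʳ-≤ A (2*[x⊓y]≤[1+x]⊓y+x⊓[1+y] x y)) neighbours≤
    s≡t⇒x≡y : A + 2 * (x ⊓ y) ≡ F + F → x ≡ y
    s≡t⇒x≡y eq =
      [1+x]⊓y+x⊓[1+y]≤2*[x⊓y]⇒≡ (+-cancelˡ-≤ A _ _ (≤-trans neighbours≤ (≤-reflexive (sym eq))))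
    x≡y⇒s≡t : x ≡ y → A + 2 * (x ⊓ y) ≡ F + F
    x≡y⇒s≡t refl = +-cancelˡ-≡ (1 + x + x) _ _ (begin
      (1 + x + x) + (A + 2 * (x ⊓ x)) ≡⟨ splitCost-odd-odd x x ⟨
      splitCost (1 + 2 * x) (1 + 2 * x) ≡⟨ splitCost-diagonal (1 + 2 * x) ⟩
      f ((1 + 2 * x) + (1 + 2 * x)) ≡⟨ f-odd+odd x x ⟩
      (1 + x + x) + (F + F) ∎)

  data EvenOdd : ℕ → Set where
    even : ∀ x → EvenOdd (2 * x)
    odd  : ∀ x → EvenOdd (1 + 2 * x)

  evenOdd : ∀ n → EvenOdd n
  evenOdd zero = even 0
  evenOdd (suc n) with evenOdd n
  ... | even x = odd x
  ... | odd x  = subst EvenOdd (2+2*x≡2*[1+x] x) (even (1 + x))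
    where
    2+2*x≡2*[1+x] : ∀ x → 2 * (1 + x) ≡ 2 + 2 * x
    2+2*x≡2*[1+x] = solve-∀

  private
    n≤2*n : ∀ n → n ≤ 2 * n
    n≤2*n n = m≤m+n n (n + 0)

    n<1+2*n : ∀ n → n < 1 + 2 * n
    n<1+2*n n = s≤s (n≤2*n n)

    1+n<2*[1+n] : ∀ n → 1 + n < 2 * (1 + n)
    1+n<2*[1+n] n = m<m+n (1 + n) (s≤s z≤n)

  characterise : ∀ a b → Acc _<_ (a + b) → SplitCharacterisation a b
  characterise a b (acc smaller) = byParity (evenOdd a) (evenOdd b)
    where
    rec : ∀ u v → u + v < a + b → SplitCharacterisation u v
    rec u v u+v< = characterise u v (smaller u+v<)
    byParity : EvenOdd a → EvenOdd b → SplitCharacterisation a b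
    byParity _ (even zero) = characterise-zero a
    byParity (even zero) _ = characterise-flip (characterise-zero b)
    byParity (even (suc x)) (even (suc y)) = characterise-even-even (suc x) (suc y)
      (rec (suc x) (suc y) (+-mono-<-≤ (1+n<2*[1+n] x) (n≤2*n (suc y))))
    byParity (odd x) (even (suc y)) = characterise-odd-even x (suc y)
      (rec x (suc y) (+-mono-<-≤ (n<1+2*n x) (n≤2*n (suc y))))
      (rec (suc x) (suc y) (+-mono-≤-< (n<1+2*n x) (1+n<2*[1+n] y)))
    byParity (even (suc x)) (odd y) = characterise-flip (characterise-odd-even y (suc x)
      (rec y (suc x) (subst (y + suc x <_) (+-comm (1 + 2 * y) _)
        (+-mono-<-≤ (n<1+2*n y) (n≤2*n (suc x)))))
      (rec (suc y) (suc x) (subst (suc y + suc x <_) (+-comm (1 + 2 * y) _)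
        (+-mono-≤-< (n<1+2*n y) (1+n<2*[1+n] x)))))
    byParity (odd x) (odd y) = characterise-odd-odd {x} {y}
      (proj₁ (rec (suc x) y (+-mono-≤-< (n<1+2*n x) (n<1+2*n y))))
      (proj₁ (rec x (suc y) (+-mono-<-≤ (n<1+2*n x) (n<1+2*n y))))

  splitCharacterisation : ∀ a b → SplitCharacterisation a b
  splitCharacterisation a b = characterise a b (<-wellFounded (a + b))

module NearestMultiples where
  open import Data.Nat
  open import Data.Nat.Properties
  open import Data.Nat.DivMod
  open import Data.Nat.Tactic.RingSolver
  open import Data.Product using (∃-syntax; _×_; _,_)
  open import Data.Sum using (_⊎_; inj₁; inj₂)
  open import Relation.Nullary using (yes; no)
  open import Data.Empty using (⊥-elim)
  open import Relation.Binary.PropositionalEquality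
  open ≡-Reasoning

  private
    2^suc≡2^+2^ : ∀ i → 2 ^ suc i ≡ 2 ^ i + 2 ^ i
    2^suc≡2^+2^ i = cong (2 ^ i +_) (+-identityʳ (2 ^ i))

  residue quotient : ℕ → ℕ → ℕ
  residue  i n = _%_ n (2 ^ suc i) {{m^n≢0 2 (suc i)}}
  quotient i n = _/_ n (2 ^ suc i) {{m^n≢0 2 (suc i)}}

  residue+quotient : ∀ i n → n ≡ residue i n + quotient i n * 2 ^ suc i
  residue+quotient i n = m≡m%n+[m/n]*n n (2 ^ suc i) {{m^n≢0 2 (suc i)}}

  residue<2^suc : ∀ i n → residue i n < 2 ^ suc i
  residue<2^suc i n = m%n<n n (2 ^ suc i) {{m^n≢0 2 (suc i)}}

  residue-exact : ∀ i {r} q → r < 2 ^ suc i → residue i (r + q * 2 ^ suc i) ≡ r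
  residue-exact i {r} q r< = trans ([m+kn]%n≡m%n r q (2 ^ suc i) {{m^n≢0 2 (suc i)}})
                                   (m<n⇒m%n≡m {{m^n≢0 2 (suc i)}} r<)

  NearMultiple : ℕ → ℕ → ℕ → Set
  NearMultiple i n e = e ≤ 2 ^ i × ∃[ q ] (n ≡ e + q * 2 ^ suc i ⊎ n + e ≡ q * 2 ^ suc i)

  d≡residue : ∀ i n → residue i n ≤ 2 ^ i → d (suc i) n ≡ residue i n
  d≡residue i n r≤h = trans (cong (2 ^ i ∸_) (m≤n⇒∣m-n∣≡n∸m r≤h)) (m∸[m∸n]≡n r≤h)

  d+residue≡2^suc : ∀ i n → 2 ^ i ≤ residue i n → d (suc i) n + residue i n ≡ 2 ^ suc i
  d+residue≡2^suc i n h≤r = begin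
    h ∸ ∣ r - h ∣ + r         ≡⟨ cong (λ k → h ∸ k + r) (m≤n⇒∣n-m∣≡n∸m h≤r) ⟩
    h ∸ (r ∸ h) + r           ≡⟨ cong (h ∸ (r ∸ h) +_) (m∸n+n≡m h≤r) ⟨
    h ∸ (r ∸ h) + (r ∸ h + h) ≡⟨ +-assoc (h ∸ (r ∸ h)) (r ∸ h) h ⟨
    h ∸ (r ∸ h) + (r ∸ h) + h ≡⟨ cong (_+ h) (m∸n+n≡m r∸h≤h) ⟩
    h + h                     ≡⟨ 2^suc≡2^+2^ i ⟨
    2 ^ suc i                 ∎
    where
    h = 2 ^ i
    r = residue i n
    r∸h≤h : r ∸ h ≤ h
    r∸h≤h = subst (r ∸ h ≤_) (m+n∸m≡n h h)
              (∸-monoˡ-≤ h (<⇒≤ (subst (r <_) (2^suc≡2^+2^ i) (residue<2^suc i n))))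

  d-nearMultiple : ∀ i n → NearMultiple i n (d (suc i) n)
  d-nearMultiple i n with residue i n ≤? 2 ^ i
  ... | yes r≤h = m∸n≤m (2 ^ i) ∣ residue i n - 2 ^ i ∣ , quotient i n , inj₁ (begin
    n                                      ≡⟨ residue+quotient i n ⟩
    residue i n + quotient i n * 2 ^ suc i  ≡⟨ cong (_+ quotient i n * 2 ^ suc i) (d≡residue i n r≤h) ⟨
    d (suc i) n + quotient i n * 2 ^ suc i  ∎)
  ... | no r≰h = m∸n≤m (2 ^ i) ∣ residue i n - 2 ^ i ∣ , 1 + quotient i n , inj₂ (begin
    n + D                     ≡⟨ cong (_+ D) (residue+quotient i n) ⟩
    residue i n + m + D       ≡⟨ regroup (residue i n) m D ⟩
    (D + residue i n) + m     ≡⟨ cong (_+ m) (d+residue≡2^suc i n (<⇒≤ (≰⇒> r≰h))) ⟩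
    2 ^ suc i + m             ∎)
    where
    D = d (suc i) n
    m = quotient i n * 2 ^ suc i
    regroup : ∀ r m e → r + m + e ≡ (e + r) + m
    regroup = solve-∀

  above-multiple⇒d : ∀ i {e} q → e ≤ 2 ^ i → d (suc i) (e + q * 2 ^ suc i) ≡ e
  above-multiple⇒d i q e≤h = trans (d≡residue i _ (subst (_≤ 2 ^ i) (sym r≡e) e≤h)) r≡e
    where
    r≡e = residue-exact i q (≤-<-trans e≤h (^-monoʳ-< 2 (s≤s (s≤s z≤n)) (n<1+n i)))

  nearMultiple⇒d : ∀ i {n e} → NearMultiple i n e → d (suc i) n ≡ e
  nearMultiple⇒d i (e≤h , q , inj₁ refl) = above-multiple⇒d i q e≤h
  nearMultiple⇒d i {n} {zero} (e≤h , q , inj₂ n+0≡) =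
    subst (λ m → d (suc i) m ≡ 0) (trans (sym n+0≡) (+-identityʳ n)) (above-multiple⇒d i q e≤h)
  nearMultiple⇒d i {n} {suc _} (_ , zero , inj₂ n+e≡0) = ⊥-elim (m+1+n≢0 n n+e≡0)
  nearMultiple⇒d i {n} {e@(suc _)} (e≤h , suc q , inj₂ n+e≡) =
    +-cancelʳ-≡ (residue i n) _ _ (begin
      d (suc i) n + residue i n ≡⟨ d+residue≡2^suc i n (subst (2 ^ i ≤_) (sym r≡M∸e) h≤M∸e) ⟩
      M                         ≡⟨ m+[n∸m]≡n e≤M ⟨
      e + (M ∸ e)               ≡⟨ cong (e +_) r≡M∸e ⟨
      e + residue i n           ∎)
    where
    M = 2 ^ suc i
    e≤M : e ≤ M
    e≤M = ≤-trans e≤h (m≤m+n (2 ^ i) _)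
    h≤M∸e : 2 ^ i ≤ M ∸ e
    h≤M∸e = subst (_≤ M ∸ e) (trans (cong (_∸ 2 ^ i) (2^suc≡2^+2^ i)) (m+n∸n≡m (2 ^ i) (2 ^ i)))
                  (∸-monoʳ-≤ M e≤h)
    swap : ∀ a b c → a + b + c ≡ a + c + b
    swap = solve-∀
    n≡ : n ≡ (M ∸ e) + q * M
    n≡ = +-cancelʳ-≡ e _ _ (begin
      n + e                 ≡⟨ n+e≡ ⟩
      M + q * M             ≡⟨ cong (_+ q * M) (m∸n+n≡m e≤M) ⟨
      (M ∸ e + e) + q * M   ≡⟨ swap (M ∸ e) e (q * M) ⟩
      (M ∸ e) + q * M + e   ∎)
    r≡M∸e : residue i n ≡ M ∸ e
    r≡M∸e = trans (cong (residue i) n≡) (residue-exact i q (∸-monoʳ-< (s≤s z≤n) e≤M))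

module CeilingLog where
  open import Data.Nat
  open import Data.Nat.Properties
  open import Data.Nat.Logarithm
  open import Data.Nat.Induction using (Acc; acc; <-wellFounded)
  open import Function.Bundles using (_⇔_; mk⇔)
  open import Relation.Nullary using (yes; no; contradiction)
  open import Relation.Binary.PropositionalEquality

  n≤2^⌈log₂n⌉ : ∀ n → n ≤ 2 ^ clg n
  n≤2^⌈log₂n⌉ n = go n (<-wellFounded n)
    where
    go : ∀ n → Acc _<_ n → n ≤ 2 ^ clg n
    go zero          _            = z≤n
    go (suc zero)    _            = m^n>0 2 (clg 1)
    go n@(suc (suc k)) (acc smaller) = begin
      n                                   ≡⟨ ⌊n/2⌋+⌈n/2⌉≡n n ⟨
      ⌊ n /2⌋ + ⌈ n /2⌉                   ≤⟨ +-monoˡ-≤ ⌈ n /2⌉ (⌊n/2⌋≤⌈n/2⌉ n) ⟩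
      ⌈ n /2⌉ + ⌈ n /2⌉                   ≤⟨ +-mono-≤ half≤ half≤ ⟩
      2 ^ clg ⌈ n /2⌉ + 2 ^ clg ⌈ n /2⌉   ≡⟨ cong (2 ^ clg ⌈ n /2⌉ +_) (+-identityʳ _) ⟨
      2 ^ suc (clg ⌈ n /2⌉)               ≡⟨ cong (λ c → 2 ^ suc c) (⌈log₂⌈n/2⌉⌉≡⌈log₂n⌉∸1 n) ⟩
      2 ^ suc (clg n ∸ 1)                 ≡⟨ cong (2 ^_) (suc-pred (clg n)) ⟩
      2 ^ clg n                           ∎
      where
      open ≤-Reasoning
      half≤ = go ⌈ n /2⌉ (smaller (⌈n/2⌉<n k))
      instance
        clg-nonZero : NonZero (clg n)
        clg-nonZero = >-nonZero (⌈log₂⌉-mono-≤ {2} {n} (s≤s (s≤s z≤n)))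

  <⌈log₂⌉⇔2^< : ∀ {j n} → j < clg n ⇔ 2 ^ j < n
  <⌈log₂⌉⇔2^< {j} {n} = mk⇔ to from
    where
    to : j < clg n → 2 ^ j < n
    to j<clg with 2 ^ j <? n
    ... | yes 2^j<n = 2^j<n
    ... | no 2^j≮n =
      contradiction (subst (clg n ≤_) (⌈log₂2^n⌉≡n j) (⌈log₂⌉-mono-≤ (≮⇒≥ 2^j≮n))) (<⇒≱ j<clg)
    from : 2 ^ j < n → j < clg n
    from 2^j<n with j <? clg n
    ... | yes j<clg = j<clg
    ... | no j≮clg = contradiction (≤-trans (n≤2^⌈log₂n⌉ n) (^-monoʳ-≤ 2 (≮⇒≥ j≮clg))) (<⇒≱ 2^j<n)

module Gaps where
  open import Data.Nat
  open import Data.Empty using (⊥-elim)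
  open import Data.Nat.Properties
  open import Data.Nat.Divisibility using (_∣_; divides; ∣⇒≤)
  open import Data.Nat.Tactic.RingSolver
  open import Data.Fin using (Fin; toℕ; fromℕ<)
  open import Data.Fin.Properties using (toℕ<n; toℕ-fromℕ<)
  open import Data.Product using (Σ; ∃-syntax; _,_; proj₁; proj₂)
  open import Data.Sum using (_⊎_; inj₁; inj₂)
  open import Function.Bundles using (_⇔_; mk⇔; module Equivalence)
  open import Function.Properties.Equivalence using () renaming (trans to ⇔-trans)
  open import Relation.Binary.PropositionalEquality
  open Equivalence using (to; from)
  open ≡-Reasoning
  open DyadicPairs
  open OptimalSplits
  open NearestMultiples
  open CeilingLog

  Gap : ℕ → ℕ → ℕ → Set
  Gap n a b = Σ (Fin (clg n)) λ j → a ≡ b + d (suc (toℕ j)) n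

  d<n : ∀ {n} (j : Fin (clg n)) → d (suc (toℕ j)) n < n
  d<n {n} j = ≤-<-trans (proj₁ (d-nearMultiple (toℕ j) n)) (to <⌈log₂⌉⇔2^< (toℕ<n j))

  private
    2*n≡n+n : ∀ n → 2 * n ≡ n + n
    2*n≡n+n = solve-∀

    double≡multiple⇒∣ : ∀ i {x} q → x + x ≡ q * 2 ^ suc i → 2 ^ i ∣ x
    double≡multiple⇒∣ i {x} q x+x≡ = divides q (*-cancelˡ-≡ x (q * 2 ^ i) 2 (begin
      2 * x            ≡⟨ 2*n≡n+n x ⟩
      x + x            ≡⟨ x+x≡ ⟩
      q * (2 * 2 ^ i)  ≡⟨ *-comm-middle q (2 ^ i) ⟩
      2 * (q * 2 ^ i)  ∎))
      where
      *-comm-middle : ∀ q h → q * (2 * h) ≡ 2 * (q * h)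
      *-comm-middle = solve-∀

  gap⇒dyadic : ∀ i {a b} → a ≡ b + d (suc i) (a + b) → Dyadic a b
  gap⇒dyadic i {a} {b} a≡b+D = i , within , divisor (proj₂ (d-nearMultiple i (a + b)))
    where
    D = d (suc i) (a + b)
    within : Within i a b
    within = ≤-trans (≤-reflexive a≡b+D) (+-monoʳ-≤ b (proj₁ (d-nearMultiple i (a + b)))) ,
             ≤-trans (≤-trans (m≤m+n b D) (≤-reflexive (sym a≡b+D))) (m≤m+n a _)
    regroup : ∀ d b → d + (b + b) ≡ (b + d) + b
    regroup = solve-∀
    divisor : ∃[ q ] (a + b ≡ D + q * 2 ^ suc i ⊎ a + b + D ≡ q * 2 ^ suc i) → 2 ^ i ∣ a ⊎ 2 ^ i ∣ b
    divisor (q , inj₁ n≡D+qM) = inj₂ (double≡multiple⇒∣ i q (+-cancelˡ-≡ D _ _ (begin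
      D + (b + b)        ≡⟨ regroup D b ⟩
      (b + D) + b        ≡⟨ cong (_+ b) a≡b+D ⟨
      a + b              ≡⟨ n≡D+qM ⟩
      D + q * 2 ^ suc i  ∎)))
    divisor (q , inj₂ n+D≡qM) = inj₁ (double≡multiple⇒∣ i q (begin
      a + a              ≡⟨ cong (a +_) a≡b+D ⟩
      a + (b + D)        ≡⟨ +-assoc a b D ⟨
      a + b + D          ≡⟨ n+D≡qM ⟩
      q * 2 ^ suc i      ∎))

  gap⇒1≤ : ∀ {a b} (j : Fin (clg (a + b))) → a ≡ b + d (suc (toℕ j)) (a + b) → 1 ≤ b
  gap⇒1≤ {a} {zero}  j a≡D = ⊥-elim (<⇒≢ (d<n j) (trans (sym a≡D) (sym (+-identityʳ a))))
  gap⇒1≤ {b = suc _} _ _   = s≤s z≤n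

  ≡+⇔2*≡+ : ∀ {a b e} → a ≡ b + e ⇔ 2 * a ≡ (a + b) + e
  ≡+⇔2*≡+ {a} {b} {e} = mk⇔
    (λ a≡b+e → trans (2*n≡n+n a) (trans (cong (a +_) a≡b+e) (sym (+-assoc a b e))))
    (λ 2a≡ → +-cancelˡ-≡ a _ _ (trans (sym (2*n≡n+n a)) (trans 2a≡ (+-assoc a b e))))

  ≡+⇒2*≡∸ : ∀ {a b e} → a ≡ b + e → 2 * b ≡ (a + b) ∸ e
  ≡+⇒2*≡∸ {b = b} {e} refl = sym (trans (cong (_∸ e) (regroup b e)) (m+n∸n≡m (2 * b) e))
    where
    regroup : ∀ b e → b + e + b ≡ 2 * b + e
    regroup = solve-∀

  dyadic⇒gap : ∀ {a b} → b ≤ a → 1 ≤ b → Dyadic a b → Gap (a + b) a b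
  dyadic⇒gap {a} {b} b≤a 1≤b (j , (a≤b+h , _) , div) =
    fromℕ< j<clg , subst (λ i → a ≡ b + d (suc i) (a + b)) (sym (toℕ-fromℕ< j<clg)) a≡b+D
    where
    h = 2 ^ j
    e = a ∸ b
    1≤a = ≤-trans 1≤b b≤a
    a≡b+e : a ≡ b + e
    a≡b+e = sym (m+[n∸m]≡n b≤a)
    regroup₁ : ∀ q h e → (q * h + e) + q * h ≡ e + q * (2 * h)
    regroup₁ = solve-∀
    regroup₂ : ∀ q h → q * h + q * h ≡ q * (2 * h)
    regroup₂ = solve-∀
    nearness : 2 ^ j ∣ a ⊎ 2 ^ j ∣ b → ∃[ q ] (a + b ≡ e + q * 2 ^ suc j ⊎ a + b + e ≡ q * 2 ^ suc j)
    nearness (inj₂ (divides q b≡qh)) = q , inj₁ (begin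
      a + b              ≡⟨ cong (_+ b) a≡b+e ⟩
      (b + e) + b        ≡⟨ cong (λ x → (x + e) + x) b≡qh ⟩
      (q * h + e) + q * h ≡⟨ regroup₁ q h e ⟩
      e + q * 2 ^ suc j  ∎)
    nearness (inj₁ (divides q a≡qh)) = q , inj₂ (begin
      a + b + e          ≡⟨ +-assoc a b e ⟩
      a + (b + e)        ≡⟨ cong (a +_) a≡b+e ⟨
      a + a              ≡⟨ cong (λ x → x + x) a≡qh ⟩
      q * h + q * h      ≡⟨ regroup₂ q h ⟩
      q * 2 ^ suc j      ∎)
    e≤h : e ≤ h
    e≤h = subst (e ≤_) (m+n∸m≡n b h) (∸-monoˡ-≤ b a≤b+h)
    a≡b+D : a ≡ b + d (suc j) (a + b)
    a≡b+D = trans a≡b+e (cong (b +_) (sym (nearMultiple⇒d j (e≤h , nearness div))))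
    2^j<n : 2 ^ j ∣ a ⊎ 2 ^ j ∣ b → 2 ^ j < a + b
    2^j<n (inj₁ h∣a) = ≤-<-trans (∣⇒≤ {{>-nonZero 1≤a}} h∣a) (m<m+n a 1≤b)
    2^j<n (inj₂ h∣b) = ≤-<-trans (∣⇒≤ {{>-nonZero 1≤b}} h∣b) (m<n+m b 1≤a)
    j<clg : j < clg (a + b)
    j<clg = from <⌈log₂⌉⇔2^< (2^j<n div)

  tight⇔gap : ∀ {a b} → b ≤ a → 1 ≤ b → f (a + b) ≡ b + f b + f a ⇔ Gap (a + b) a b
  tight⇔gap {a} {b} b≤a 1≤b =
    ⇔-trans (mk⇔ (λ eq → trans cost≡ (sym eq)) (λ eq → trans (sym eq) cost≡))
    (⇔-trans (proj₂ (splitCharacterisation a b))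
             (mk⇔ (dyadic⇒gap b≤a 1≤b) (λ (j , a≡b+D) → gap⇒dyadic (toℕ j) a≡b+D)))
    where
    reorder : ∀ b x y → x + y + b ≡ b + y + x
    reorder = solve-∀
    cost≡ : splitCost a b ≡ b + f b + f a
    cost≡ = trans (cong (f a + f b +_) (m≥n⇒m⊓n≡n b≤a)) (reorder b (f a) (f b))

module Coordinates where
  open import Data.Nat
  open import Data.Nat.Properties
  open import Data.Nat.DivMod
  open import Data.List using ([]; [_]; _++_; length; filter; upTo)
  open import Data.List.Properties using (filter-++; length-++; upTo-∷ʳ; filter-accept; filter-reject)
  open import Data.Nat.Tactic.RingSolver
  open import Data.Product using (_×_; _,_; proj₁)
  open import Data.Sum using (inj₂)
  open import Data.Empty using (⊥-elim)
  open import Function.Base using (_∘_)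
  open import Relation.Nullary using (¬_; yes; no)
  open import Relation.Binary.PropositionalEquality hiding ([_])
  open ≡-Reasoning
  open NearestMultiples

  bit : ℕ → ℕ → ℕ
  bit i m = (_/_ m (2 ^ i) {{m^n≢0 2 i}}) % 2

  count : ℕ → ℕ → ℕ → ℕ
  count i v n = length (filter (λ m → bit i m ≟ v) (upTo n))

  count-suc : ∀ i v n → count i v (suc n) ≡ count i v n + length (filter (λ m → bit i m ≟ v) [ n ])
  count-suc i v n = begin
    length (filter P? (upTo (suc n)))                ≡⟨ cong (length ∘ filter P?) (upTo-∷ʳ n) ⟨
    length (filter P? (upTo n ++ [ n ]))             ≡⟨ cong length (filter-++ P? (upTo n) [ n ]) ⟩
    length (filter P? (upTo n) ++ filter P? [ n ])   ≡⟨ length-++ (filter P? (upTo n)) ⟩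
    count i v n + length (filter P? [ n ])           ∎
    where P? = λ m → bit i m ≟ v

  count-suc-accept : ∀ i v n → bit i n ≡ v → count i v (suc n) ≡ suc (count i v n)
  count-suc-accept i v n bit≡v = trans (count-suc i v n)
    (trans (cong (λ xs → count i v n + length xs) (filter-accept (λ m → bit i m ≟ v) {xs = []} bit≡v))
           (+-comm (count i v n) 1))

  count-suc-reject : ∀ i v n → ¬ bit i n ≡ v → count i v (suc n) ≡ count i v n
  count-suc-reject i v n bit≢v = trans (count-suc i v n)
    (trans (cong (λ xs → count i v n + length xs) (filter-reject (λ m → bit i m ≟ v) {xs = []} bit≢v))
           (+-identityʳ (count i v n)))

  bit≡residue/2^ : ∀ i n → bit i n ≡ _/_ (residue i n) (2 ^ i) {{m^n≢0 2 i}}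
  bit≡residue/2^ i n = sym (m%[n*o]/o≡m/o%n n 2 (2 ^ i) {{_}} {{m^n≢0 2 i}} {{m^n≢0 2 (suc i)}})

  residue<⇒bit≡0 : ∀ i n → residue i n < 2 ^ i → bit i n ≡ 0
  residue<⇒bit≡0 i n r<h = trans (bit≡residue/2^ i n) (m<n⇒m/n≡0 {{m^n≢0 2 i}} r<h)

  residue≥⇒bit≡1 : ∀ i n → 2 ^ i ≤ residue i n → bit i n ≡ 1
  residue≥⇒bit≡1 i n h≤r = begin
    bit i n                     ≡⟨ bit≡residue/2^ i n ⟩
    _/_ r h {{m^n≢0 2 i}}        ≡⟨ m/n≡1+[m∸n]/n {{m^n≢0 2 i}} h≤r ⟩
    1 + _/_ (r ∸ h) h {{m^n≢0 2 i}} ≡⟨ cong suc (m<n⇒m/n≡0 {{m^n≢0 2 i}} r∸h<h) ⟩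
    1                            ∎
    where
    h = 2 ^ i
    r = residue i n
    r∸h<h : r ∸ h < h
    r∸h<h = subst (r ∸ h <_) (m+n∸m≡n h h)
              (∸-monoˡ-< (subst (r <_) (cong (h +_) (+-identityʳ h)) (residue<2^suc i n)) h≤r)

  residue<⇒d-suc : ∀ i n → residue i n < 2 ^ i → d (suc i) (suc n) ≡ suc (d (suc i) n)
  residue<⇒d-suc i n r<h = begin
    d (suc i) (suc n)                                    ≡⟨ cong (d (suc i) ∘ suc) (residue+quotient i n) ⟩
    d (suc i) (suc (residue i n) + quotient i n * 2 ^ suc i) ≡⟨ above-multiple⇒d i (quotient i n) r<h ⟩
    suc (residue i n)                                    ≡⟨ cong suc (d≡residue i n (<⇒≤ r<h)) ⟨
    suc (d (suc i) n)                                    ∎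

  residue≥⇒d-suc : ∀ i n → 2 ^ i ≤ residue i n → d (suc i) n ≡ suc (d (suc i) (suc n))
  residue≥⇒d-suc i n h≤r with d (suc i) n | d+residue≡2^suc i n h≤r | proj₁ (d-nearMultiple i n)
  ... | zero  | r≡M   | _   = ⊥-elim (<-irrefl r≡M (residue<2^suc i n))
  ... | suc e | e+r≡M | e<h = cong suc (sym (nearMultiple⇒d i (<⇒≤ e<h , 1 + quotient i n , inj₂ (begin
    suc n + e                              ≡⟨ +-suc n e ⟨
    n + suc e                              ≡⟨ cong (_+ suc e) (residue+quotient i n) ⟩
    residue i n + quotient i n * 2 ^ suc i + suc e ≡⟨ regroup (residue i n) _ (suc e) ⟩
    (suc e + residue i n) + quotient i n * 2 ^ suc i ≡⟨ cong (_+ quotient i n * 2 ^ suc i) e+r≡M ⟩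
    2 ^ suc i + quotient i n * 2 ^ suc i   ∎))))
    where
    regroup : ∀ r m e → r + m + e ≡ (e + r) + m
    regroup = solve-∀

  count-balance : ∀ i n → count i 0 n + count i 1 n ≡ n × count i 0 n ≡ count i 1 n + d (suc i) n
  count-balance i zero = refl , sym (above-multiple⇒d i 0 z≤n)
  count-balance i (suc n) with count-balance i n | residue i n <? 2 ^ i
  ... | total , balance | yes r<h
    rewrite count-suc-accept i 0 n (residue<⇒bit≡0 i n r<h)
          | count-suc-reject i 1 n (λ bit≡1 → 0≢1+n (trans (sym (residue<⇒bit≡0 i n r<h)) bit≡1))
          | residue<⇒d-suc i n r<h
    = cong suc total , trans (cong suc balance) (sym (+-suc _ _))
  ... | total , balance | no r≮h
    rewrite count-suc-reject i 0 n (λ bit≡0 → 0≢1+n (trans (sym bit≡0) (residue≥⇒bit≡1 i n (≮⇒≥ r≮h))))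
          | count-suc-accept i 1 n (residue≥⇒bit≡1 i n (≮⇒≥ r≮h))
          | residue≥⇒d-suc i n (≮⇒≥ r≮h)
    = trans (+-suc _ _) (cong suc total) , trans balance (+-suc _ _)

module HypercubicBipartitions where
  open import Data.Nat
  open import Data.Nat.Properties
  open import Data.Fin using (Fin; toℕ; opposite)
  open import Data.Fin.Properties using (toℕ<n; opposite-prop; opposite-involutive)
  open import Data.Product using (_×_; _,_; proj₁; proj₂)
  open import Data.Sum using (_⊎_; inj₁; inj₂)
  open import Function.Bundles using (module Equivalence)
  open import Relation.Binary.PropositionalEquality
  open Equivalence using (to)
  open ≡-Reasoning
  open CeilingLog
  open Coordinates
  open Gaps

  -- Coordinate j of β̃_k reads the bit of weight 2^(k ∸ 1 ∸ j), so coordinate `opposite j` reads bit j.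
  countSide-opposite : ∀ {k} (j : Fin k) v n → countSide k (opposite j) v n ≡ count (toℕ j) v n
  countSide-opposite {k} j v n =
    cong (λ i → count i v n) (trans (sym (opposite-prop (opposite j))) (cong toℕ (opposite-involutive j)))

  hcbp⇒gap : ∀ {a b} → IsHCBP (a + b) a b → Gap (a + b) a b
  hcbp⇒gap {a} {b} (_ , _ , b≤a , _ , j , sides) =
    opposite j , subst (λ i → a ≡ b + d (suc i) n) (sym (opposite-prop j)) (oriented sides)
    where
    n = a + b
    i = clg n ∸ suc (toℕ j)
    D = d (suc i) n
    balance : count i 0 n ≡ count i 1 n + D
    balance = proj₂ (count-balance i n)
    oriented : (count i 0 n ≡ a × count i 1 n ≡ b) ⊎ (count i 0 n ≡ b × count i 1 n ≡ a) → a ≡ b + D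
    oriented (inj₁ (c₀≡a , c₁≡b)) = trans (sym c₀≡a) (trans balance (cong (_+ D) c₁≡b))
    oriented (inj₂ (c₀≡b , c₁≡a)) = trans a≡b (trans b≡a+D (cong (_+ D) a≡b))
      where
      b≡a+D = trans (sym c₀≡b) (trans balance (cong (_+ D) c₁≡a))
      a≡b = ≤-antisym (≤-trans (m≤m+n a D) (≤-reflexive (sym b≡a+D))) b≤a

  gap⇒hcbp : ∀ {a b} → b ≤ a → 1 ≤ b → Gap (a + b) a b → IsHCBP (a + b) a b
  gap⇒hcbp {a} {b} b≤a 1≤b (j , a≡b+D) =
    to <⌈log₂⌉⇔2^< (≤-<-trans z≤n (toℕ<n j)) , refl , b≤a , 1≤b , opposite j ,
    inj₁ (trans (countSide-opposite j 0 n) c₀≡a , trans (countSide-opposite j 1 n) c₁≡b)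
    where
    n = a + b
    i = toℕ j
    D = d (suc i) n
    c₀ = count i 0 n
    c₁ = count i 1 n
    c₀≡a : c₀ ≡ a
    c₀≡a = *-cancelˡ-≡ c₀ a 2 (begin
      2 * c₀          ≡⟨ to ≡+⇔2*≡+ (proj₂ (count-balance i n)) ⟩
      (c₀ + c₁) + D   ≡⟨ cong (_+ D) (proj₁ (count-balance i n)) ⟩
      (a + b) + D     ≡⟨ to ≡+⇔2*≡+ a≡b+D ⟨
      2 * a           ∎)
    c₁≡b : c₁ ≡ b
    c₁≡b = +-cancelʳ-≡ D c₁ b (trans (sym (proj₂ (count-balance i n))) (trans c₀≡a a≡b+D))

open import Data.Nat using (ℕ; suc; _≤_)
open import Data.Integer using (ℤ; +_; _+_; _-_; _*_; ∣_∣) renaming (_≤_ to _≤ℤ_)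
open import Data.Fin using (Fin; toℕ)
open import Data.Product using (Σ; _×_)
open import Function.Bundles using (_⇔_)
open import Relation.Binary.PropositionalEquality using (_≡_)

import Data.Nat as ℕ
import Data.Nat.Properties as ℕₚ
open import Data.Integer using (-[1+_]; +≤+)
open import Data.Integer.Properties using (m-n≡m⊖n; ⊖-≥; +-injective; pos-*)
open import Data.Product using (_,_)
open import Data.Empty using (⊥; ⊥-elim)
open import Function.Bundles using (mk⇔; module Equivalence)
open import Function.Properties.Equivalence using () renaming (trans to ⇔-trans; sym to ⇔-sym)
open import Relation.Binary.PropositionalEquality using (refl; sym; trans; cong)
open Equivalence using (to; from)
open Gaps
open HypercubicBipartitions

GapSplit : ℕ → ℕ → Set
GapSplit a b = b ≤ a × 1 ≤ b × Gap (a ℕ.+ b) a b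

+n-+m≡+[n∸m] : ∀ {n m} → m ≤ n → + n - + m ≡ + (n ℕ.∸ m)
+n-+m≡+[n∸m] {n} {m} m≤n = trans (m-n≡m⊖n n m) (⊖-≥ m≤n)

hcbp-condition⇔ : ∀ a b → ((+ 1 ≤ℤ + b) × (+ b ≤ℤ + a) × IsHCBP (a ℕ.+ b) a b) ⇔ GapSplit a b
hcbp-condition⇔ a b = mk⇔ (λ { (+≤+ 1≤b , +≤+ b≤a , hcbp) → b≤a , 1≤b , hcbp⇒gap hcbp })
                          (λ (b≤a , 1≤b , gap) → +≤+ 1≤b , +≤+ b≤a , gap⇒hcbp b≤a 1≤b gap)

recurrence-condition⇔ : ∀ a b →
  ((f (a ℕ.+ b) ≡ b ℕ.+ f b ℕ.+ f a) × (+ b ≤ℤ + a) × (+ 1 ≤ℤ + b)) ⇔ GapSplit a b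
recurrence-condition⇔ a b =
  mk⇔ (λ { (tight , +≤+ b≤a , +≤+ 1≤b) → b≤a , 1≤b , to (tight⇔gap b≤a 1≤b) tight })
      (λ (b≤a , 1≤b , gap) → from (tight⇔gap b≤a 1≤b) gap , +≤+ b≤a , +≤+ 1≤b)

distance-condition⇔ : ∀ a b → let n = a ℕ.+ b in
  Σ (Fin (clg n)) (λ j → (+ 2 * + a ≡ + n + + d (suc (toℕ j)) n) × (+ 2 * + b ≡ + n - + d (suc (toℕ j)) n))
  ⇔ GapSplit a b
distance-condition⇔ a b = mk⇔
  (λ (j , 2a≡n+D , _) → let a≡b+D = from ≡+⇔2*≡+ (+-injective (trans (pos-* 2 a) 2a≡n+D)) in
     ℕₚ.≤-trans (ℕₚ.m≤m+n b _) (ℕₚ.≤-reflexive (sym a≡b+D)) , gap⇒1≤ j a≡b+D , j , a≡b+D)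
  (λ (_ , _ , j , a≡b+D) →
     j , trans (sym (pos-* 2 a)) (cong +_ (to ≡+⇔2*≡+ a≡b+D)) ,
     trans (sym (pos-* 2 b)) (trans (cong +_ (≡+⇒2*≡∸ {a} {b} a≡b+D))
                                    (sym (+n-+m≡+[n∸m] (ℕₚ.<⇒≤ (d<n {a ℕ.+ b} j))))))

-[1+]≢+ : ∀ {m n} → -[1+ m ] ≡ + n → ⊥
-[1+]≢+ ()

theorem13 : (n : ℕ) → 1 ≤ n → (n0 n1 : ℤ) → n0 + n1 ≡ + n →
    let C1 = (+ 1 ≤ℤ n1) × (n1 ≤ℤ n0) × IsHCBP n ∣ n0 ∣ ∣ n1 ∣
        C2 = (f n ≡ ∣ n1 ∣ Data.Nat.+ f ∣ n1 ∣ Data.Nat.+ f ∣ n0 ∣) × (n1 ≤ℤ n0) × (+ 1 ≤ℤ n1)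
        C3 = Σ (Fin (clg n)) (λ j →
               (+ 2 * n0 ≡ + n + + d (suc (toℕ j)) n) × (+ 2 * n1 ≡ + n - + d (suc (toℕ j)) n))
    in (C1 ⇔ C2) × (C1 ⇔ C3)
theorem13 .(a ℕ.+ b) _ (+ a) (+ b) refl =
  ⇔-trans (hcbp-condition⇔ a b) (⇔-sym (recurrence-condition⇔ a b)) ,
  ⇔-trans (hcbp-condition⇔ a b) (⇔-sym (distance-condition⇔ a b))
theorem13 n _ n0 -[1+ _ ] _ =
  mk⇔ (λ { (() , _) }) (λ { (_ , _ , ()) }) ,
  mk⇔ (λ { (() , _) })
      (λ (j , _ , 2n1≡) → ⊥-elim (-[1+]≢+ (trans 2n1≡ (+n-+m≡+[n∸m] (ℕₚ.<⇒≤ (d<n {n} j))))))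
theorem13 n _ -[1+ _ ] (+ _) _ =
  mk⇔ (λ { (_ , () , _) }) (λ { (_ , () , _) }) ,
  mk⇔ (λ { (_ , () , _) }) (λ { (_ , () , _) })
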